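{- Let $\mathbb{A}$ be an epistemic Heyting algebra, $a\in\mathbb{A}$, $b\in\mathbb{A}$ and $i$ an agent. The following are equivalent: (1) $[b]\in\mathsf{Min}_i(\mathbb{A}^a)$; (2) there is a unique $b'\in\mathsf{Min}_i(\mathbb{A})$ such that $b'\wedge a\neq\bot$ and $[b]=[b']$.
   Context: A monadic Heyting algebra is $\langle\mathbb{L},(\lozenge_i),(\Box_i)\rangle$ with $\mathbb{L}$ a Heyting algebra and monotone unary $\lozenge_i,\Box_i$ such that for all $a,b$: $a\le\lozenge_ia$; $\Box_ia\le a$; $\lozenge_i(a\vee b)\le\lozenge_ia\vee\lozenge_ib$; $\Box_i(a\to b)\le\Box_ia\to\Box_ib$; $\lozenge_ia\le\Box_i\lozenge_ia$; $\lozenge_i\Box_ia\le\Box_ia$; $\Box_i(a\to b)\le\lozenge_ia\to\lozenge_ib$; $\lozenge_i\bot\le\bot$; $\top\le\Box_i\top$. An epistemic Heyting algebra is a finite monadic Heyting algebra with $\lozenge_ia\vee\neg\lozenge_ia=\top$. An element $c$ is $i$-minimal if $c\neq\bot$, $\lozenge_ic=c$, and whenever $d<c$ and $\lozenge_id=d$ then $d=\bot$; $\mathsf{Min}_i(\cdot)$ is the set of $i$-minimal elements. The pseudo-quotient $\mathbb{A}^a=(\mathbb{L}/{\cong_a},(\lozenge^a_i),(\Box^a_i))$: $b\cong_ac$ iff $b\wedge a=c\wedge a$, $[c]$ is the class of $c$, the Heyting operations are induced, $\lozenge^a_i[b]=[\lozenge_i(b\wedge a)]$, $\Box^a_i[b]=[\Box_i(a\to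 b)]$. -}

module Defs where

open import Level using (Level; _⊔_) renaming (suc to lsuc)
open import Data.Nat using (ℕ)
open import Data.Fin using (Fin)
open import Data.Product using (Σ; ∃; _×_; _,_)
open import Relation.Nullary using (¬_)
open import Relation.Binary.Lattice.Bundles using (HeytingAlgebra)

record MonadicHeytingAlgebra (Agent : Set) (c ℓ₁ ℓ₂ : Level)
       : Set (lsuc (c ⊔ ℓ₁ ⊔ ℓ₂)) where
  field
    heyting : HeytingAlgebra c ℓ₁ ℓ₂
  open HeytingAlgebra heyting public
  field
    ◇ □     : Agent → Carrier → Carrier
    ◇-mono  : ∀ i {a b} → a ≤ b → ◇ i a ≤ ◇ i b
    □-mono  : ∀ i {a b} → a ≤ b → □ i a ≤ □ i b
    ax1 : ∀ i a → a ≤ ◇ i a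
    ax2 : ∀ i a → □ i a ≤ a
    ax3 : ∀ i a b → ◇ i (a ∨ b) ≤ ◇ i a ∨ ◇ i b
    ax4 : ∀ i a b → □ i (a ⇨ b) ≤ □ i a ⇨ □ i b
    ax5 : ∀ i a → ◇ i a ≤ □ i (◇ i a)
    ax6 : ∀ i a → ◇ i (□ i a) ≤ □ i a
    ax7 : ∀ i a b → □ i (a ⇨ b) ≤ ◇ i a ⇨ ◇ i b
    ax8 : ∀ i → ◇ i ⊥ ≤ ⊥
    ax9 : ∀ i → ⊤ ≤ □ i ⊤

  ¬ₕ_ : Carrier → Carrier
  ¬ₕ x = x ⇨ ⊥

record EpistemicHeytingAlgebra (Agent : Set) (c ℓ₁ ℓ₂ : Level)
       : Set (lsuc (c ⊔ ℓ₁ ⊔ ℓ₂)) where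
  field
    monadic : MonadicHeytingAlgebra Agent c ℓ₁ ℓ₂
  open MonadicHeytingAlgebra monadic public
  field
    finite : Σ ℕ λ n → Σ (Fin n → Carrier) λ f → ∀ x → ∃ λ k → f k ≈ x
    ◇-decided : ∀ i a → (◇ i a ∨ (¬ₕ ◇ i a)) ≈ ⊤

IsMinimal : ∀ {c ℓ₁ ℓ₂} {C : Set c} (_≈_ : C → C → Set ℓ₁) (_≤_ : C → C → Set ℓ₂)
            (◇ : C → C) (⊥ : C) → C → Set (c ⊔ ℓ₁ ⊔ ℓ₂)
IsMinimal _≈_ _≤_ ◇ ⊥ c =
  ¬ (c ≈ ⊥) × (◇ c ≈ c) ×
  (∀ d → (d ≤ c × ¬ (d ≈ c)) → ◇ d ≈ d → d ≈ ⊥)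

module _ {Agent : Set} {c ℓ₁ ℓ₂} (A : EpistemicHeytingAlgebra Agent c ℓ₁ ℓ₂) where
  open EpistemicHeytingAlgebra A

  Min : Agent → Carrier → Set (c ⊔ ℓ₁ ⊔ ℓ₂)
  Min i = IsMinimal _≈_ _≤_ (◇ i) ⊥

  -- Pseudo-quotient A^a, represented on the carrier of A via the
  -- congruence b ≅ₐ c iff b ∧ a = c ∧ a ([b] = [c]).
  _≅[_]_ : Carrier → Carrier → Carrier → Set ℓ₁
  b ≅[ a ] d = (b ∧ a) ≈ (d ∧ a)

  _≤[_]_ : Carrier → Carrier → Carrier → Set ℓ₁
  b ≤[ a ] d = (b ∧ d) ≅[ a ] b

  ◇^ : Carrier → Agent → Carrier → Carrier
  ◇^ a i b = ◇ i (b ∧ a)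

  □^ : Carrier → Agent → Carrier → Carrier
  □^ a i b = □ i (a ⇨ b)

  MinQ : Carrier → Agent → Carrier → Set (c ⊔ ℓ₁)
  MinQ a i = IsMinimal (λ x y → x ≅[ a ] y) (λ x y → x ≤[ a ] y) (◇^ a i) ⊥

-- Write e = ◇ᵢ(b ∧ a). The class [b] is ◇ᵢᵃ-fixed exactly when [b] = [e], and
-- i-minimality of [b] in the quotient transfers to i-minimality of e in A: a
-- closed d < e missing a forces b ∧ a ≤ ¬d, hence e ≤ ¬d as ¬d is closed.
-- Conversely every i-minimal m is the closure of each of its elements x ≠ ⊥:
-- m ∧ ¬◇ᵢx is closed and strictly below m, so it is ⊥, and since ◇ᵢx is
-- complemented this gives m ≤ ◇ᵢx. This yields both the uniqueness of the
-- representative and the converse implication.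
module Submission where

open import Data.Product using (∃!; _×_; _,_)
open import Function.Bundles using (_⇔_; mk⇔)
open import Relation.Nullary using (¬_)
open import Defs

module MonadicProperties {Agent : Set} {c ℓ₁ ℓ₂}
                         (M : MonadicHeytingAlgebra Agent c ℓ₁ ℓ₂) where
  open MonadicHeytingAlgebra M
  open import Relation.Binary.Reasoning.PartialOrder poset

  Closed : Agent → Carrier → Set ℓ₂
  Closed i x = ◇ i x ≤ x

  ◇-closed : ∀ i x → Closed i (◇ i x)
  ◇-closed i x = begin
    ◇ i (◇ i x)       ≤⟨ ◇-mono i (ax5 i x) ⟩
    ◇ i (□ i (◇ i x)) ≤⟨ ax6 i (◇ i x) ⟩
    □ i (◇ i x)       ≤⟨ ax2 i (◇ i x) ⟩
    ◇ i x             ∎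

  closed⇒◇≈ : ∀ {i x} → Closed i x → ◇ i x ≈ x
  closed⇒◇≈ {i} {x} x-closed = antisym x-closed (ax1 i x)

  closed⇒≤□ : ∀ {i x} → Closed i x → x ≤ □ i x
  closed⇒≤□ {i} {x} x-closed = begin
    x           ≤⟨ ax1 i x ⟩
    ◇ i x       ≤⟨ ax5 i x ⟩
    □ i (◇ i x) ≤⟨ □-mono i x-closed ⟩
    □ i x       ∎

  closed-frobenius : ∀ {i x} z → Closed i x → x ∧ ◇ i z ≤ ◇ i (z ∧ x)
  closed-frobenius {i} {x} z x-closed = transpose-∧ (begin
    x                       ≤⟨ closed⇒≤□ x-closed ⟩
    □ i x                   ≤⟨ □-mono i (transpose-⇨ (∧-greatest (x∧y≤y _ _) (x∧y≤x _ _))) ⟩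
    □ i (z ⇨ z ∧ x)         ≤⟨ ax7 i z (z ∧ x) ⟩
    ◇ i z ⇨ ◇ i (z ∧ x)     ∎)

  ¬ₕ-closed : ∀ {i x} → Closed i x → Closed i (¬ₕ x)
  ¬ₕ-closed {i} {x} x-closed = transpose-⇨ (begin
    ◇ i (¬ₕ x) ∧ x      ≤⟨ ∧-greatest (x∧y≤y _ _) (x∧y≤x _ _) ⟩
    x ∧ ◇ i (¬ₕ x)      ≤⟨ closed-frobenius (¬ₕ x) x-closed ⟩
    ◇ i (¬ₕ x ∧ x)      ≤⟨ ◇-mono i (transpose-∧ refl) ⟩
    ◇ i ⊥               ≤⟨ ax8 i ⟩
    ⊥                   ∎)

  ≤¬ₕ⇒≤⊥ : ∀ {x} → x ≤ ¬ₕ x → x ≤ ⊥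
  ≤¬ₕ⇒≤⊥ {x} x≤¬x = trans (∧-greatest refl refl) (transpose-∧ x≤¬x)

  ≤⊥⇒≈⊥ : ∀ {x} → x ≤ ⊥ → x ≈ ⊥
  ≤⊥⇒≈⊥ {x} x≤⊥ = antisym x≤⊥ (minimum x)

module EpistemicProperties {Agent : Set} {c ℓ₁ ℓ₂}
                           (A : EpistemicHeytingAlgebra Agent c ℓ₁ ℓ₂) where
  open EpistemicHeytingAlgebra A
  open MonadicProperties monadic
  open import Relation.Binary.Lattice.Properties.JoinSemilattice joinSemilattice
    using (∨-monotonic)
  open import Relation.Binary.Lattice.Properties.HeytingAlgebra heyting
    using (⇨ˡ-contravariant; ∧-distribˡ-∨-≤)
  open import Relation.Binary.Lattice.Properties.MeetSemilattice meetSemilattice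
    using (∧-monotonic)
  open import Relation.Binary.Reasoning.PartialOrder poset

  closed-complemented : ∀ {i x} → Closed i x → ⊤ ≤ x ∨ ¬ₕ x
  closed-complemented {i} {x} x-closed = begin
    ⊤                      ≈⟨ Eq.sym (◇-decided i x) ⟩
    ◇ i x ∨ ¬ₕ ◇ i x       ≤⟨ ∨-monotonic x-closed (⇨ˡ-contravariant (ax1 i x)) ⟩
    x ∨ ¬ₕ x               ∎

  ◇-below-Min : ∀ {i m x} → Min A i m → x ≤ m → ◇ i x ≤ m
  ◇-below-Min {i} (_ , m-fixed , _) x≤m = trans (◇-mono i x≤m) (reflexive m-fixed)

  Min-◇-below : ∀ {i m x} → Min A i m → x ≤ m → ¬ (◇ i x ≈ m) → x ≤ ⊥
  Min-◇-below {i} {m} {x} m-min@(_ , _ , m-minimal) x≤m ◇x≉m = begin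
    x      ≤⟨ ax1 i x ⟩
    ◇ i x  ≈⟨ m-minimal (◇ i x) (◇-below-Min m-min x≤m , ◇x≉m) (closed⇒◇≈ (◇-closed i x)) ⟩
    ⊥      ∎

  Min-≤-closed : ∀ {i m e} → Min A i m → Closed i e → ¬ (e ≤ ⊥) → e ≤ m → m ≤ e
  Min-≤-closed {i} {m} {e} m-min e-closed e≰⊥ e≤m = begin
    m                  ≤⟨ ∧-greatest refl (trans (maximum m) (closed-complemented e-closed)) ⟩
    m ∧ (e ∨ ¬ₕ e)     ≤⟨ ∧-distribˡ-∨-≤ m e (¬ₕ e) ⟩
    m ∧ e ∨ m ∧ ¬ₕ e   ≤⟨ ∨-least (x∧y≤y m e) (trans m∧¬e≤⊥ (minimum e)) ⟩
    e                  ∎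
    where
    ◇[m∧¬e]≤¬e : ◇ i (m ∧ ¬ₕ e) ≤ ¬ₕ e
    ◇[m∧¬e]≤¬e = trans (◇-mono i (x∧y≤y m (¬ₕ e))) (¬ₕ-closed e-closed)
    ◇[m∧¬e]≉m : ¬ (◇ i (m ∧ ¬ₕ e) ≈ m)
    ◇[m∧¬e]≉m ◇[m∧¬e]≈m =
      e≰⊥ (≤¬ₕ⇒≤⊥ (trans e≤m (trans (reflexive (Eq.sym ◇[m∧¬e]≈m)) ◇[m∧¬e]≤¬e)))
    m∧¬e≤⊥ : m ∧ ¬ₕ e ≤ ⊥
    m∧¬e≤⊥ = Min-◇-below m-min (x∧y≤x m (¬ₕ e)) ◇[m∧¬e]≉m

  Min⇒◇≈ : ∀ {i m x} → Min A i m → x ≤ m → ¬ (x ≤ ⊥) → ◇ i x ≈ m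
  Min⇒◇≈ {i} {m} {x} m-min x≤m x≰⊥ =
    antisym (◇-below-Min m-min x≤m)
            (Min-≤-closed m-min (◇-closed i x) (λ ◇x≤⊥ → x≰⊥ (trans (ax1 i x) ◇x≤⊥))
                          (◇-below-Min m-min x≤m))

  module Quotient (a : Carrier) where

    ∧≤⇒≤[] : ∀ {d b} → d ∧ a ≤ b ∧ a → ((d ∧ b) ∧ a) ≈ (d ∧ a)
    ∧≤⇒≤[] {d} {b} da≤ba = antisym (∧-monotonic (x∧y≤x d b) refl)
      (∧-greatest (∧-greatest (x∧y≤x d a) (trans da≤ba (x∧y≤x b a))) (x∧y≤y d a))

    ≤[]⇒∧≤ : ∀ {d b} → ((d ∧ b) ∧ a) ≈ (d ∧ a) → d ∧ a ≤ b ∧ a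
    ≤[]⇒∧≤ {d} {b} d≤b = trans (reflexive (Eq.sym d≤b)) (∧-monotonic (x∧y≤y d b) refl)

    ≤⊥⇒≅⊥ : ∀ {b} → b ∧ a ≤ ⊥ → (b ∧ a) ≈ (⊥ ∧ a)
    ≤⊥⇒≅⊥ ba≤⊥ = antisym (trans ba≤⊥ (minimum _)) (trans (x∧y≤x ⊥ a) (minimum _))

    ≅⊥⇒≤⊥ : ∀ {b} → (b ∧ a) ≈ (⊥ ∧ a) → b ∧ a ≤ ⊥
    ≅⊥⇒≤⊥ b≅⊥ = trans (reflexive b≅⊥) (x∧y≤x ⊥ a)

    ≤◇ᵃ : ∀ i b → b ∧ a ≤ ◇ i (b ∧ a) ∧ a
    ≤◇ᵃ i b = ∧-greatest (ax1 i (b ∧ a)) (x∧y≤y b a)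

    ◇ᵃ-fixed : ∀ {i b} → ◇ i (b ∧ a) ∧ a ≤ b ∧ a → (◇ i (b ∧ a) ∧ a) ≈ (b ∧ a)
    ◇ᵃ-fixed {i} {b} ◇ᵃb≤b = antisym ◇ᵃb≤b (≤◇ᵃ i b)

    closed⇒◇ᵃ-fixed : ∀ {i d} → Closed i d → (◇ i (d ∧ a) ∧ a) ≈ (d ∧ a)
    closed⇒◇ᵃ-fixed {i} {d} d-closed =
      ◇ᵃ-fixed (∧-monotonic (trans (◇-mono i (x∧y≤x d a)) d-closed) refl)

    MinQ⇒≰⊥ : ∀ {i b} → MinQ A a i b → ¬ (b ∧ a ≤ ⊥)
    MinQ⇒≰⊥ (b≇⊥ , _) ba≤⊥ = b≇⊥ (≤⊥⇒≅⊥ ba≤⊥)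

    MinQ⇒Min-◇ : ∀ {i b} → MinQ A a i b → Min A i (◇ i (b ∧ a))
    MinQ⇒Min-◇ {i} {b} q@(_ , b-fixed , b-minimal) =
      e≉⊥ , closed⇒◇≈ (◇-closed i (b ∧ a)) , e-minimal
      where
      e : Carrier
      e = ◇ i (b ∧ a)
      e≉⊥ : ¬ (e ≈ ⊥)
      e≉⊥ e≈⊥ = MinQ⇒≰⊥ q (trans (ax1 i (b ∧ a)) (reflexive e≈⊥))
      e-minimal : ∀ d → d ≤ e × ¬ (d ≈ e) → ◇ i d ≈ d → d ≈ ⊥
      e-minimal d (d≤e , d≉e) d-fixed = ≤⊥⇒≈⊥ (≤¬ₕ⇒≤⊥ (trans d≤e e≤¬d))
        where
        d-closed : Closed i d
        d-closed = reflexive d-fixed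
        da≤ba : d ∧ a ≤ b ∧ a
        da≤ba = trans (∧-monotonic d≤e refl) (reflexive b-fixed)
        d≇b : ¬ ((d ∧ a) ≈ (b ∧ a))
        d≇b d≅b = d≉e (antisym d≤e (begin
          ◇ i (b ∧ a)  ≤⟨ ◇-mono i (reflexive (Eq.sym d≅b)) ⟩
          ◇ i (d ∧ a)  ≤⟨ ◇-mono i (x∧y≤x d a) ⟩
          ◇ i d        ≤⟨ d-closed ⟩
          d            ∎))
        da≤⊥ : d ∧ a ≤ ⊥
        da≤⊥ = ≅⊥⇒≤⊥ (b-minimal d (∧≤⇒≤[] da≤ba , d≇b) (closed⇒◇ᵃ-fixed d-closed))
        ba≤¬d : b ∧ a ≤ ¬ₕ d
        ba≤¬d = transpose-⇨ (trans (∧-greatest (x∧y≤y _ d) (trans (x∧y≤x _ d) (x∧y≤y b a))) da≤⊥)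
        e≤¬d : e ≤ ¬ₕ d
        e≤¬d = trans (◇-mono i ba≤¬d) (¬ₕ-closed d-closed)

    Min-rep⇒MinQ : ∀ {i m b} → Min A i m → ¬ ((m ∧ a) ≈ ⊥) → (b ∧ a) ≈ (m ∧ a) → MinQ A a i b
    Min-rep⇒MinQ {i} {m} {b} m-min m∧a≉⊥ b≅m = b≇⊥ , b-fixed , b-minimal
      where
      ba≤m : b ∧ a ≤ m
      ba≤m = trans (reflexive b≅m) (x∧y≤x m a)
      b≇⊥ : ¬ ((b ∧ a) ≈ (⊥ ∧ a))
      b≇⊥ b≅⊥ = m∧a≉⊥ (≤⊥⇒≈⊥ (trans (reflexive (Eq.sym b≅m)) (≅⊥⇒≤⊥ b≅⊥)))
      b-fixed : (◇ i (b ∧ a) ∧ a) ≈ (b ∧ a)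
      b-fixed = ◇ᵃ-fixed (begin
        ◇ i (b ∧ a) ∧ a  ≤⟨ ∧-monotonic (◇-below-Min m-min ba≤m) refl ⟩
        m ∧ a            ≈⟨ Eq.sym b≅m ⟩
        b ∧ a            ∎)
      b-minimal : ∀ d → ((d ∧ b) ∧ a) ≈ (d ∧ a) × ¬ ((d ∧ a) ≈ (b ∧ a)) →
                  (◇ i (d ∧ a) ∧ a) ≈ (d ∧ a) → (d ∧ a) ≈ (⊥ ∧ a)
      b-minimal d (d≤b , d≇b) d-fixed =
        ≤⊥⇒≅⊥ (Min-◇-below m-min (trans (≤[]⇒∧≤ d≤b) ba≤m) ◇[da]≉m)
        where
        ◇[da]≉m : ¬ (◇ i (d ∧ a) ≈ m)
        ◇[da]≉m ◇[da]≈m = d≇b (antisym (≤[]⇒∧≤ d≤b) (begin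
          b ∧ a            ≈⟨ b≅m ⟩
          m ∧ a            ≤⟨ ∧-monotonic (reflexive (Eq.sym ◇[da]≈m)) refl ⟩
          ◇ i (d ∧ a) ∧ a  ≈⟨ d-fixed ⟩
          d ∧ a            ∎))

proposition9 : ∀ {Agent : Set} {c ℓ₁ ℓ₂} (A : EpistemicHeytingAlgebra Agent c ℓ₁ ℓ₂)
    (a b : EpistemicHeytingAlgebra.Carrier A) (i : Agent) →
    MinQ A a i b ⇔
      ∃! (EpistemicHeytingAlgebra._≈_ A)
         (λ b′ → Min A i b′ ×
                 ¬ (EpistemicHeytingAlgebra._≈_ A (EpistemicHeytingAlgebra._∧_ A b′ a)
                                                  (EpistemicHeytingAlgebra.⊥ A)) ×
                 _≅[_]_ A b a b′)
proposition9 A a b i = mk⇔ forward backward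
  where
  open EpistemicHeytingAlgebra A
  open EpistemicProperties A
  open Quotient a

  forward : MinQ A a i b → ∃! _≈_ (λ m → Min A i m × ¬ ((m ∧ a) ≈ ⊥) × (b ∧ a) ≈ (m ∧ a))
  forward q@(_ , b-fixed , _) =
    ◇ i (b ∧ a) , (MinQ⇒Min-◇ q , e∧a≉⊥ , Eq.sym b-fixed) , unique
    where
    e∧a≉⊥ : ¬ ((◇ i (b ∧ a) ∧ a) ≈ ⊥)
    e∧a≉⊥ e∧a≈⊥ = MinQ⇒≰⊥ q (trans (≤◇ᵃ i b) (reflexive e∧a≈⊥))
    unique : ∀ {m} → Min A i m × ¬ ((m ∧ a) ≈ ⊥) × (b ∧ a) ≈ (m ∧ a) → ◇ i (b ∧ a) ≈ m
    unique (m-min , _ , b≅m) = Min⇒◇≈ m-min (trans (reflexive b≅m) (x∧y≤x _ a)) (MinQ⇒≰⊥ q)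

  backward : ∃! _≈_ (λ m → Min A i m × ¬ ((m ∧ a) ≈ ⊥) × (b ∧ a) ≈ (m ∧ a)) → MinQ A a i b
  backward (_ , (m-min , m∧a≉⊥ , b≅m) , _) = Min-rep⇒MinQ m-min m∧a≉⊥ b≅m
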